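{- Let $k\geq 2$ and let $b,c$ be integers with $k^2+1\leq b<c\leq k^2+k$. Suppose $x=[0;k,a_2,a_3,\dots]\in T_b\cap T_c$, and let $a_2$ have $l$ digits in base $b$ and $m$ digits in base $c$. Then $m>k\log k$ (natural logarithm).
   Context: A real number $x$ is a Trott number in base $b$ if $x\in(0,1)$ has an infinite continued fraction expansion $x=[0;a_1,a_2,\dots]$ with all $a_i$ positive integers and the base-$b$ expansion of $x$ is $(0.\hat{a}_1\hat{a}_2\hat{a}_3\dots)_b$, where $\hat{a}_i$ is the string of base-$b$ digits of $a_i$ (without leading zeros), concatenated. $T_b$ is the set of Trott numbers in base $b$. -}

module Defs where

open import Data.Nat using (ℕ; zero; suc; _+_; _*_; _^_; _≤_; _<_; _<ᵇ_; _!)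

open import Data.Bool using (if_then_else_)
open import Data.Product using (_×_; _,_; proj₁; proj₂; ∃-syntax)
open import Data.Sum using (_⊎_)

-- Convention: a continued fraction x = [0; a₁, a₂, a₃, …] is represented by
-- a sequence  a : ℕ → ℕ  with  a i = a_{i+1}  (so a 0 = a₁, a 1 = a₂, …).

-- Number of base-b digits of n (for b ≥ 2, n ≥ 1): the least L with n < b^L.
-- The search starts at L = 0 and has fuel n + 1, which suffices since n < b^n.
ndigitsAux : ℕ → ℕ → ℕ → ℕ → ℕ
ndigitsAux zero    b n L = L
ndigitsAux (suc f) b n L = if n <ᵇ b ^ L then L else ndigitsAux f b n (suc L)

ndigits : ℕ → ℕ → ℕ
ndigits b n = ndigitsAux (suc n) b n 0

-- Convergents: conv a n = ((p_{n-1}, q_{n-1}) , (p_n , q_n)),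
-- with p_{-1} = 1, q_{-1} = 0, p_0 = 0, q_0 = 1,
-- p_{n+1} = a_{n+1} p_n + p_{n-1},  q_{n+1} = a_{n+1} q_n + q_{n-1}.
conv : (ℕ → ℕ) → ℕ → (ℕ × ℕ) × (ℕ × ℕ)
conv a zero = ((1 , 0) , (0 , 1))
conv a (suc n) with conv a n
... | ((p , q) , (p' , q')) = ((p' , q') , (a n * p' + p , a n * q' + q))

P Q : (ℕ → ℕ) → ℕ → ℕ
P a n = proj₁ (proj₂ (conv a n))
Q a n = proj₂ (proj₂ (conv a n))

-- The first N blocks \hat a_1 … \hat a_N of the base-b digit string, concatenated:
-- its length and the integer it represents.
concatLen : ℕ → (ℕ → ℕ) → ℕ → ℕ
concatLen b a zero    = 0
concatLen b a (suc N) = concatLen b a N + ndigits b (a N)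

concatVal : ℕ → (ℕ → ℕ) → ℕ → ℕ
concatVal b a zero    = 0
concatVal b a (suc N) = concatVal b a N * b ^ ndigits b (a N) + a N

-- The real number [0; a₁, a₂, …] lies in every closed interval I_n with endpoints
-- p_n/q_n and p_{n+1}/q_{n+1}; the real number (0.\hat a_1 \hat a_2 …)_b lies in
-- every closed interval J_N = [v/B, (v+1)/B] with v = concatVal b a N, B = b^concatLen b a N.
-- Both families are nested with lengths → 0, so the two reals are equal iff every
-- I_n meets every J_N.  (Rational comparisons are cross-multiplied in ℕ.)
CFEqualsBase : ℕ → (ℕ → ℕ) → Set
CFEqualsBase b a = ∀ n N →
  let p  = P a n ; q  = Q a n
      p' = P a (suc n) ; q' = Q a (suc n)
      v  = concatVal b a N ; B = b ^ concatLen b a N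
  in ((p * B ≤ (v + 1) * q) ⊎ (p' * B ≤ (v + 1) * q'))   -- min I_n ≤ max J_N
   × ((v * q ≤ p * B) ⊎ (v * q' ≤ p' * B))                -- min J_N ≤ max I_n

IsTrott : ℕ → (ℕ → ℕ) → Set
IsTrott b a = (∀ i → 1 ≤ a i) × CFEqualsBase b a

-- expScaled m N = N! · Σ_{i=0}^{N} m^i / i!   (an integer)
expScaled : ℕ → ℕ → ℕ
expScaled m zero    = 1
expScaled m (suc N) = suc N * expScaled m N + m ^ suc N

-- e^m > t  (for naturals m, t): some partial sum of the exponential series exceeds t.
ExpGreater : ℕ → ℕ → Set
ExpGreater m t = ∃[ N ] (t * N ! < expScaled m N)

-- m > k · ln k  (for k ≥ 1)  ⇔  e^m > k^k
GtKLogK : ℕ → ℕ → Set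
GtKLogK m k = ExpGreater m (k ^ k)

{-# OPTIONS --safe #-}
-- Write A = a₂, X = b^l and Y = c^m. Since k < b, c, the first two digit blocks put x in
-- [(kX+A)/(bX), (kX+A+1)/(bX)] and in [(kY+A)/(cY), (kY+A+1)/(cY)], while the continued
-- fraction puts x between [0;k,A] = A/(Ak+1) and [0;k,A+1] = (A+1)/(Ak+k+1). The two block
-- intervals must meet, which forces Y < X, so m < l and A ≥ X/b ≥ bᵐ. Comparing each block with
-- the continued-fraction bounds gives (A−k)X ≤ (A+1)(Ak+1) and A(Ak+k+1) ≤ (A+1)kY, so roughly
-- X ≤ kA ≤ kY; for A ≥ b² this is precise enough to give kX ≤ (k²+1)Y ≤ bY, while m = 1 is
-- impossible. Hence k·bᵐ ≤ cᵐ, and as c/b < 1 + 1/k we get kᵏ < (1 + 1/k)^(mk) ≤ eᵐ.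
module Submission where

open import Defs
open import Data.Nat
  using (ℕ; zero; suc; _+_; _*_; _^_; _!; _≤_; _<_; _≮_; _<ᵇ_; z≤n; s≤s; z<s; NonZero; >-nonZero)
open import Data.Nat.Properties
open import Algebra.Properties.CommutativeSemigroup *-commutativeSemigroup
  using (xy∙z≈xz∙y; x∙yz≈y∙xz; interchange)
open import Data.Nat.Tactic.RingSolver using (solve; solve-∀)
open import Data.Bool using (true; false; T)
open import Data.Unit using (tt)
open import Data.Empty using (⊥-elim)
open import Data.Product using (Σ; _×_; _,_; proj₁; proj₂)
open import Data.Sum using (_⊎_; inj₁; inj₂; swap)
open import Data.List using (_∷_; [])
open import Relation.Binary.PropositionalEquality

infix 4 _/_≤_/_

-- Comparison of fractions by cross-multiplication, as in CFEqualsBase; it is the order of ℚ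
-- only when both denominators are nonzero.
_/_≤_/_ : ℕ → ℕ → ℕ → ℕ → Set
p / q ≤ r / s = p * s ≤ r * q

/≤-trans : ∀ {p q r s t u} .{{_ : NonZero s}} → p / q ≤ r / s → r / s ≤ t / u → p / q ≤ t / u
/≤-trans {p} {q} {r} {s} {t} {u} ps≤rq ru≤ts = *-cancelʳ-≤ (p * u) (t * q) s (begin
  p * u * s ≡⟨ xy∙z≈xz∙y p u s ⟩
  p * s * u ≤⟨ *-monoˡ-≤ u ps≤rq ⟩
  r * q * u ≡⟨ xy∙z≈xz∙y r q u ⟩
  r * u * q ≤⟨ *-monoˡ-≤ q ru≤ts ⟩
  t * s * q ≡⟨ xy∙z≈xz∙y t s q ⟩
  t * q * s ∎)
  where open ≤-Reasoning

/≤-across-gap : ∀ {p q p' q' v B W C} → p * q' ≤ p' * q + 1 → B * C < q * q' →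
  v / B ≤ p / q → p' / q' ≤ W / C → v / B ≤ W / C
/≤-across-gap {p} {q} {p'} {q'} {v} {B} {W} {C} gap short vq≤pB p'C≤Wq' =
  m<1+n⇒m≤n (*-cancelʳ-< _ _ _ (begin-strict
    v * C * (q * q')           ≡⟨ solve (v ∷ C ∷ q ∷ q' ∷ []) ⟩
    v * q * (q' * C)           ≤⟨ *-monoˡ-≤ (q' * C) vq≤pB ⟩
    p * B * (q' * C)           ≡⟨ solve (p ∷ B ∷ q' ∷ C ∷ []) ⟩
    p * q' * (B * C)           ≤⟨ *-monoˡ-≤ (B * C) gap ⟩
    (p' * q + 1) * (B * C)     ≡⟨ solve (p' ∷ q ∷ B ∷ C ∷ []) ⟩
    p' * C * (q * B) + B * C   ≤⟨ +-monoˡ-≤ (B * C) (*-monoˡ-≤ (q * B) p'C≤Wq') ⟩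
    W * q' * (q * B) + B * C   <⟨ +-monoʳ-< (W * q' * (q * B)) short ⟩
    W * q' * (q * B) + q * q'  ≡⟨ solve (W ∷ q' ∷ q ∷ B ∷ []) ⟩
    (1 + W * B) * (q * q')     ∎))
  where open ≤-Reasoning

/≤-trans-⊎ʳ : ∀ {p q p' q' r s t u} .{{_ : NonZero q}} .{{_ : NonZero q'}} →
  r / s ≤ p / q → r / s ≤ p' / q' → p / q ≤ t / u ⊎ p' / q' ≤ t / u → r / s ≤ t / u
/≤-trans-⊎ʳ {p} {q} {p'} {q'} {r} {s} {t} {u} r≤p _ (inj₁ p≤t) =
  /≤-trans {r} {s} {p} {q} {t} {u} r≤p p≤t
/≤-trans-⊎ʳ {p} {q} {p'} {q'} {r} {s} {t} {u} _ r≤p' (inj₂ p'≤t) =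
  /≤-trans {r} {s} {p'} {q'} {t} {u} r≤p' p'≤t

/≤-trans-⊎ˡ : ∀ {p q p' q' r s t u} .{{_ : NonZero q}} .{{_ : NonZero q'}} →
  t / u ≤ p / q ⊎ t / u ≤ p' / q' → p / q ≤ r / s → p' / q' ≤ r / s → t / u ≤ r / s
/≤-trans-⊎ˡ {p} {q} {p'} {q'} {r} {s} {t} {u} (inj₁ t≤p) p≤r _ =
  /≤-trans {t} {u} {p} {q} {r} {s} t≤p p≤r
/≤-trans-⊎ˡ {p} {q} {p'} {q'} {r} {s} {t} {u} (inj₂ t≤p') _ p'≤r =
  /≤-trans {t} {u} {p'} {q'} {r} {s} t≤p' p'≤r

Unimodular : ℕ → ℕ → ℕ → ℕ → Set
Unimodular p q p' q' = p' * q ≡ p * q' + 1 ⊎ p * q' ≡ p' * q + 1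

unimodular-gap : ∀ {p q p' q'} → Unimodular p q p' q' → p * q' ≤ p' * q + 1
unimodular-gap {p} {q} {p'} {q'} (inj₁ e) =
  ≤-trans (m≤m+n (p * q') 1) (≤-trans (≤-reflexive (sym e)) (m≤m+n (p' * q) 1))
unimodular-gap (inj₂ e) = ≤-reflexive e

unimodular-step : ∀ x {p q p' q'} → Unimodular p q p' q' → Unimodular p' q' (x * p' + p) (x * q' + q)
unimodular-step x {p} {q} {p'} {q'} (inj₁ e) = inj₂ (begin
  p' * (x * q' + q)           ≡⟨ solve (x ∷ q ∷ p' ∷ q' ∷ []) ⟩
  x * p' * q' + p' * q        ≡⟨ cong (x * p' * q' +_) e ⟩
  x * p' * q' + (p * q' + 1)  ≡⟨ solve (x ∷ p ∷ p' ∷ q' ∷ []) ⟩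
  (x * p' + p) * q' + 1       ∎)
  where open ≡-Reasoning
unimodular-step x {p} {q} {p'} {q'} (inj₂ e) = inj₁ (begin
  (x * p' + p) * q'           ≡⟨ solve (x ∷ p ∷ p' ∷ q' ∷ []) ⟩
  x * p' * q' + p * q'        ≡⟨ cong (x * p' * q' +_) e ⟩
  x * p' * q' + (p' * q + 1)  ≡⟨ solve (x ∷ q ∷ p' ∷ q' ∷ []) ⟩
  p' * (x * q' + q) + 1       ∎)
  where open ≡-Reasoning

convergent-det : ∀ a n → Unimodular (P a n) (Q a n) (P a (suc n)) (Q a (suc n))
convergent-det a zero = inj₁ (cong (λ y → (y + 1) * 1) (*-zeroʳ (a 0)))
convergent-det a (suc n) = unimodular-step (a (suc n)) (convergent-det a n)

-- v/B and W/C are at distance 0 or at least 1/(BC), while the interval between p/q and p'/q'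
-- has length 1/(qq') < 1/(BC); so if the interval reaches down to W/C and up to v/B, then v/B ≤ W/C.
/≤-through-unimodular : ∀ {p q p' q' v B W C} .{{_ : NonZero q}} .{{_ : NonZero q'}} →
  Unimodular p q p' q' → B * C < q * q' →
  v / B ≤ p / q ⊎ v / B ≤ p' / q' → p / q ≤ W / C ⊎ p' / q' ≤ W / C → v / B ≤ W / C
/≤-through-unimodular {p} {q} {p'} {q'} {v} {B} {W} {C} u short = go
  where
  go : v / B ≤ p / q ⊎ v / B ≤ p' / q' → p / q ≤ W / C ⊎ p' / q' ≤ W / C → v / B ≤ W / C
  go (inj₁ v≤p) (inj₁ p≤W) = /≤-trans {v} {B} {p} {q} {W} {C} v≤p p≤W
  go (inj₂ v≤p') (inj₂ p'≤W) = /≤-trans {v} {B} {p'} {q'} {W} {C} v≤p' p'≤W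
  go (inj₁ v≤p) (inj₂ p'≤W) = /≤-across-gap {p} {q} {p'} {q'} {v} {B} {W} {C}
    (unimodular-gap {p} {q} {p'} {q'} u) short v≤p p'≤W
  go (inj₂ v≤p') (inj₁ p≤W) = /≤-across-gap {p'} {q'} {p} {q} {v} {B} {W} {C}
    (unimodular-gap {p'} {q'} {p} {q} (swap u)) (subst (B * C <_) (*-comm q q') short) v≤p' p≤W

module _ {a : ℕ → ℕ} (pos : ∀ i → 0 < a i) where

  Q-step : ∀ n → Q a (suc n) + Q a n ≤ Q a (suc (suc n))
  Q-step n = +-monoˡ-≤ (Q a n) (m≤n*m (Q a (suc n)) (a (suc n)) {{>-nonZero (pos (suc n))}})

  Q-pos : ∀ n → 0 < Q a n
  Q-pos zero = z<s
  Q-pos (suc zero) = subst (0 <_) (sym (trans (+-identityʳ _) (*-identityʳ (a 0)))) (pos 0)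
  Q-pos (suc (suc n)) = <-≤-trans (Q-pos (suc n)) (≤-trans (m≤m+n _ (Q a n)) (Q-step n))

  n≤Q : ∀ n → n ≤ Q a n
  n≤Q zero = z≤n
  n≤Q (suc zero) = Q-pos 1
  n≤Q (suc (suc n)) =
    ≤-trans (≤-reflexive (+-comm 1 (suc n))) (≤-trans (+-mono-≤ (n≤Q (suc n)) (Q-pos n)) (Q-step n))

-- Both blocks meet every interval I_n; take n so large that I_n is shorter than 1/(BC).
trott-blocks-overlap : ∀ {a b c} → IsTrott b a → IsTrott c a → ∀ N N' →
  concatVal b a N / b ^ concatLen b a N ≤ (concatVal c a N' + 1) / c ^ concatLen c a N'
trott-blocks-overlap {a} {b} {c} (pos , b-expansion) (_ , c-expansion) N N' =
  /≤-through-unimodular {P a n} {Q a n} {P a (suc n)} {Q a (suc n)} {concatVal b a N} {B} {concatVal c a N' + 1} {C}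
    {{>-nonZero (Q-pos pos n)}} {{>-nonZero (Q-pos pos (suc n))}}
    (convergent-det a n) short (proj₂ (b-expansion n N)) (proj₁ (c-expansion n N'))
  where
  B C n : ℕ
  B = b ^ concatLen b a N
  C = c ^ concatLen c a N'
  n = suc (B * C)
  short : B * C < Q a n * Q a (suc n)
  short = <-≤-trans (n≤Q pos n) (m≤m*n (Q a n) (Q a (suc n)) {{>-nonZero (Q-pos pos (suc n))}})

n<b^n : ∀ {b} → 2 ≤ b → ∀ n → n < b ^ n
n<b^n 2≤b zero = z<s
n<b^n {b} 2≤b (suc n) = ≤-<-trans (n<b^n 2≤b n) (^-monoʳ-< b 2≤b (n<1+n n))

ndigitsAux-bounds : ∀ {b n} f L → b ^ L ≤ b * n → n < b ^ (L + f) →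
  n < b ^ ndigitsAux f b n L × b ^ ndigitsAux f b n L ≤ b * n
ndigitsAux-bounds {b} {n} zero L lo hi = subst (λ e → n < b ^ e) (+-identityʳ L) hi , lo
ndigitsAux-bounds {b} {n} (suc f) L lo hi with n <ᵇ b ^ L in eq
... | true = <ᵇ⇒< n (b ^ L) (subst T (sym eq) tt) , lo
... | false = ndigitsAux-bounds f (suc L) (*-monoʳ-≤ b (≮⇒≥ n≮b^L)) (subst (λ e → n < b ^ e) (+-suc L f) hi)
  where
  n≮b^L : n ≮ b ^ L
  n≮b^L n<b^L = subst T eq (<⇒<ᵇ n<b^L)

ndigits-bounds : ∀ {b n} → 2 ≤ b → 0 < n → n < b ^ ndigits b n × b ^ ndigits b n ≤ b * n
ndigits-bounds {b} {n} 2≤b 0<n = ndigitsAux-bounds (suc n) 0 (*-mono-≤ (<⇒≤ 2≤b) 0<n) (<⇒≤ (n<b^n 2≤b (suc n)))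

ndigits-digit : ∀ {b n} → 0 < n → n < b → ndigits b n ≡ 1
ndigits-digit {b} {suc n} _ n<b with suc n <ᵇ b * 1 | <⇒<ᵇ (subst (suc n <_) (sym (*-identityʳ b)) n<b)
... | true | _ = refl

-- cf[k,A] = [0;k,A] = A/(Ak+1), cf[k,A,x] = [0;k,A,x] and cf[k,A+1] = [0;k,A+1] = (A+1)/(Ak+k+1).
cf[k,A]≤cf[k,A,x] : ∀ k A x → A / (A * k + 1) ≤ (x * A + 1) / (x * (A * k + 1) + k)
cf[k,A]≤cf[k,A,x] k A x = ≤-trans (m≤m+n _ 1) (≤-reflexive (identity k A x))
  where
  identity : ∀ k A x → A * (x * (A * k + 1) + k) + 1 ≡ (x * A + 1) * (A * k + 1)
  identity = solve-∀

cf[k,A]≤cf[k,A+1] : ∀ k A → A / (A * k + 1) ≤ (A + 1) / (A * k + k + 1)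
cf[k,A]≤cf[k,A+1] k A = ≤-trans (m≤m+n _ 1) (≤-reflexive (identity k A))
  where
  identity : ∀ k A → A * (A * k + k + 1) + 1 ≡ (A + 1) * (A * k + 1)
  identity = solve-∀

cf[k,A,x]≤cf[k,A+1] : ∀ k A x → 0 < x → (x * A + 1) / (x * (A * k + 1) + k) ≤ (A + 1) / (A * k + k + 1)
cf[k,A,x]≤cf[k,A+1] k A (suc t) _ = ≤-trans (m≤m+n _ t) (≤-reflexive (identity k A t))
  where
  identity : ∀ k A t → ((1 + t) * A + 1) * (A * k + k + 1) + t ≡ (A + 1) * ((1 + t) * (A * k + 1) + k)
  identity = solve-∀

module SecondBlock {a : ℕ → ℕ} (pos : ∀ i → 0 < a i) {k : ℕ} (a₀≡k : a 0 ≡ k) where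

  P₂ : P a 2 ≡ a 1
  P₂ = identity (a 1) (a 0)
    where
    identity : ∀ x y → x * (y * 0 + 1) + 0 ≡ x
    identity = solve-∀

  Q₂ : Q a 2 ≡ a 1 * k + 1
  Q₂ = trans (identity (a 1) (a 0)) (cong (λ y → a 1 * y + 1) a₀≡k)
    where
    identity : ∀ x y → x * (y * 1 + 0) + 1 ≡ x * y + 1
    identity = solve-∀

  P₃ : P a 3 ≡ a 2 * a 1 + 1
  P₃ = identity (a 2) (a 1) (a 0)
    where
    identity : ∀ z x y → z * (x * (y * 0 + 1) + 0) + (y * 0 + 1) ≡ z * x + 1
    identity = solve-∀

  Q₃ : Q a 3 ≡ a 2 * (a 1 * k + 1) + k
  Q₃ = trans (identity (a 2) (a 1) (a 0)) (cong (λ y → a 2 * (a 1 * y + 1) + y) a₀≡k)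
    where
    identity : ∀ z x y → z * (x * (y * 1 + 0) + 1) + (y * 1 + 0) ≡ z * (x * y + 1) + y
    identity = solve-∀

  private instance
    Q₂≢0 : NonZero (Q a 2)
    Q₂≢0 = >-nonZero (Q-pos pos 2)
    Q₃≢0 : NonZero (Q a 3)
    Q₃≢0 = >-nonZero (Q-pos pos 3)

  cf-lower-bound : ∀ {r s} → P a 2 / Q a 2 ≤ r / s ⊎ P a 3 / Q a 3 ≤ r / s → a 1 / (a 1 * k + 1) ≤ r / s
  cf-lower-bound {r} {s} = /≤-trans-⊎ʳ {P a 2} {Q a 2} {P a 3} {Q a 3} {a 1} {a 1 * k + 1} {r} {s} below₂ below₃
    where
    below₂ : a 1 / (a 1 * k + 1) ≤ P a 2 / Q a 2
    below₂ rewrite P₂ | Q₂ = ≤-refl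
    below₃ : a 1 / (a 1 * k + 1) ≤ P a 3 / Q a 3
    below₃ rewrite P₃ | Q₃ = cf[k,A]≤cf[k,A,x] k (a 1) (a 2)

  cf-upper-bound : ∀ {r s} → r / s ≤ P a 2 / Q a 2 ⊎ r / s ≤ P a 3 / Q a 3 → r / s ≤ (a 1 + 1) / (a 1 * k + k + 1)
  cf-upper-bound {r} {s} h = /≤-trans-⊎ˡ {P a 2} {Q a 2} {P a 3} {Q a 3} {a 1 + 1} {a 1 * k + k + 1} {r} {s} h above₂ above₃
    where
    above₂ : P a 2 / Q a 2 ≤ (a 1 + 1) / (a 1 * k + k + 1)
    above₂ rewrite P₂ | Q₂ = cf[k,A]≤cf[k,A+1] k (a 1)
    above₃ : P a 3 / Q a 3 ≤ (a 1 + 1) / (a 1 * k + k + 1)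
    above₃ rewrite P₃ | Q₃ = cf[k,A,x]≤cf[k,A+1] k (a 1) (a 2) (pos 2)

  second-block-value : ∀ z → concatVal z a 2 ≡ k * z ^ ndigits z (a 1) + a 1
  second-block-value z = cong (λ y → y * z ^ ndigits z (a 1) + a 1) a₀≡k

  second-block-scale : ∀ {z} → k < z → z ^ concatLen z a 2 ≡ z * z ^ ndigits z (a 1)
  second-block-scale {z} k<z = cong (λ e → z ^ (e + ndigits z (a 1)))
    (trans (cong (ndigits z) a₀≡k) (ndigits-digit (subst (0 <_) a₀≡k (pos 0)) k<z))

  second-block-bounds : ∀ {z} → k < z → CFEqualsBase z a →
    a 1 / (a 1 * k + 1) ≤ (k * z ^ ndigits z (a 1) + a 1 + 1) / (z * z ^ ndigits z (a 1)) ×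
    (k * z ^ ndigits z (a 1) + a 1) / (z * z ^ ndigits z (a 1)) ≤ (a 1 + 1) / (a 1 * k + k + 1)
  second-block-bounds {z} k<z expansion
    rewrite sym (second-block-value z) | sym (second-block-scale k<z) =
    cf-lower-bound {concatVal z a 2 + 1} {z ^ concatLen z a 2} (proj₁ (expansion 2 2)) ,
    cf-upper-bound {concatVal z a 2} {z ^ concatLen z a 2} (proj₂ (expansion 2 2))

  second-blocks-overlap : ∀ {b c} → k < b → k < c → IsTrott b a → IsTrott c a →
    (k * b ^ ndigits b (a 1) + a 1) / (b * b ^ ndigits b (a 1)) ≤
    (k * c ^ ndigits c (a 1) + a 1 + 1) / (c * c ^ ndigits c (a 1))
  second-blocks-overlap {b} {c} k<b k<c tb tc
    rewrite sym (second-block-value b) | sym (second-block-scale k<b)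
          | sym (second-block-value c) | sym (second-block-scale k<c) =
    trott-blocks-overlap tb tc 2 2

cf-lower≤block⇒ : ∀ {k b A X} → k * k + 1 ≤ b →
  A / (A * k + 1) ≤ (k * X + A + 1) / (b * X) → A * X ≤ k * X + (A + 1) * (A * k + 1)
cf-lower≤block⇒ {k} {b} {A} {X} k²+1≤b low = +-cancelˡ-≤ (A * k * k * X) _ _ (begin
  A * k * k * X + A * X                             ≡⟨ solve (k ∷ A ∷ X ∷ []) ⟩
  A * ((k * k + 1) * X)                             ≤⟨ *-monoʳ-≤ A (*-monoˡ-≤ X k²+1≤b) ⟩
  A * (b * X)                                       ≤⟨ low ⟩
  (k * X + A + 1) * (A * k + 1)                     ≡⟨ solve (k ∷ A ∷ X ∷ []) ⟩
  A * k * k * X + (k * X + (A + 1) * (A * k + 1))   ∎)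
  where open ≤-Reasoning

block≤cf-upper⇒ : ∀ {k c A Y} → c ≤ k * k + k →
  (k * Y + A) / (c * Y) ≤ (A + 1) / (A * k + k + 1) → A * (A * k + k + 1) ≤ (A + 1) * k * Y
block≤cf-upper⇒ {k} {c} {A} {Y} c≤k²+k up = +-cancelˡ-≤ ((A + 1) * k * k * Y) _ _ (begin
  (A + 1) * k * k * Y + A * (A * k + k + 1)           ≤⟨ m≤m+n _ (k * Y) ⟩
  (A + 1) * k * k * Y + A * (A * k + k + 1) + k * Y   ≡⟨ solve (k ∷ A ∷ Y ∷ []) ⟩
  (k * Y + A) * (A * k + k + 1)                       ≤⟨ up ⟩
  (A + 1) * (c * Y)                                   ≤⟨ *-monoʳ-≤ (A + 1) (*-monoˡ-≤ Y c≤k²+k) ⟩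
  (A + 1) * ((k * k + k) * Y)                         ≡⟨ solve (k ∷ A ∷ Y ∷ []) ⟩
  (A + 1) * k * k * Y + (A + 1) * k * Y               ∎)
  where open ≤-Reasoning

-- With X ≤ Y the base-b block would lie strictly above the base-c block.
blocks-overlap⇒< : ∀ {k b c A X Y} → 0 < k → 0 < X → b < c → c ≤ Y →
  (k * X + A) / (b * X) ≤ (k * Y + A + 1) / (c * Y) → Y < X
blocks-overlap⇒< {k} {b} {c} {A} {X} {Y} 0<k 0<X b<c c≤Y meet = ≰⇒> (λ X≤Y → <⇒≱ (above X≤Y) meet)
  where
  open ≤-Reasoning
  bX<kYX : b * X < k * (Y * X)
  bX<kYX = <-≤-trans (*-monoˡ-< X {{>-nonZero 0<X}} (<-≤-trans b<c c≤Y)) (m≤n*m (Y * X) k {{>-nonZero 0<k}})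
  above : X ≤ Y → (k * Y + A + 1) * (b * X) < (k * X + A) * (c * Y)
  above X≤Y = begin-strict
    (k * Y + A + 1) * (b * X)            ≡⟨ solve (k ∷ b ∷ A ∷ X ∷ Y ∷ []) ⟩
    k * (Y * X) * b + A * b * X + b * X  ≤⟨ +-monoˡ-≤ (b * X) (+-monoʳ-≤ (k * (Y * X) * b) (*-monoʳ-≤ (A * b) X≤Y)) ⟩
    k * (Y * X) * b + A * b * Y + b * X  <⟨ +-monoʳ-< (k * (Y * X) * b + A * b * Y) bX<kYX ⟩
    k * (Y * X) * b + A * b * Y + k * (Y * X) ≡⟨ solve (k ∷ b ∷ A ∷ X ∷ Y ∷ []) ⟩
    k * (Y * X) * (1 + b) + A * b * Y    ≤⟨ +-mono-≤ (*-monoʳ-≤ (k * (Y * X)) b<c) (*-monoˡ-≤ Y (*-monoʳ-≤ A (<⇒≤ b<c))) ⟩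
    k * (Y * X) * c + A * c * Y          ≡⟨ solve (k ∷ c ∷ A ∷ X ∷ Y ∷ []) ⟩
    (k * X + A) * (c * Y)                ∎

^-exponent-< : ∀ {b c m l} .{{_ : NonZero c}} → b ≤ c → c ^ m < b ^ l → m < l
^-exponent-< {b} {c} {m} {l} b≤c c^m<b^l = ≰⇒> (λ l≤m → <⇒≱ c^m<b^l (≤-trans (^-monoˡ-≤ l b≤c) (^-monoʳ-≤ c l≤m)))

^-exponent-pos : ∀ {c A m} → 0 < A → A < c ^ m → 0 < m
^-exponent-pos {m = zero} 0<A A<1 = ⊥-elim (<⇒≱ A<1 0<A)
^-exponent-pos {m = suc m} _ _ = z<s

-- The slack is the Horner form of (k²−k+1)(k²+1)² − k³(k+1)² − 1 at k = 2 + i.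
degree-six-bound : ∀ i → let k = 2 + i in
  (k * k + k) * ((k * k + k) * k) < (suc i * k + 1) * ((k * k + 1) * (k * k + 1))
degree-six-bound i = ≤-trans (m≤m+n _ _) (≤-reflexive (identity i))
  where
  identity : ∀ i → let k = 2 + i in
    1 + (k * k + k) * ((k * k + k) * k) + (2 + i * (39 + i * (89 + i * (85 + i * (41 + i * (10 + i))))))
      ≡ ((1 + i) * k + 1) * ((k * k + 1) * (k * k + 1))
  identity = solve-∀

cf-lower≤block-fails-for-small-A : ∀ {k A X} → 2 ≤ k → k * k + 1 ≤ A → A < k * k + k → (k * k + 1) * (k * k + 1) ≤ X →
  k * X + (A + 1) * (A * k + 1) < A * X
cf-lower≤block-fails-for-small-A {k@(suc (suc i))} {A} {X} (s≤s (s≤s z≤n)) k²+1≤A A<k²+k [k²+1]²≤X = begin-strict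
  k * X + (A + 1) * (A * k + 1)                             ≤⟨ +-monoʳ-≤ (k * X) (*-mono-≤ A+1≤k²+k Ak+1≤[k²+k]k) ⟩
  k * X + (k * k + k) * ((k * k + k) * k)                   <⟨ +-monoʳ-< (k * X) (degree-six-bound i) ⟩
  k * X + (suc i * k + 1) * ((k * k + 1) * (k * k + 1))     ≤⟨ +-monoʳ-≤ (k * X) (*-mono-≤ d-lower [k²+1]²≤X) ⟩
  k * X + d * X                                             ≡⟨ sym (*-distribʳ-+ X k d) ⟩
  (k + d) * X                                               ≡⟨ cong (_* X) k+d≡A ⟩
  A * X                                                     ∎
  where
  open ≤-Reasoning
  split : Σ ℕ λ d → k + d ≡ A
  split = m≤n⇒∃[o]m+o≡n (≤-trans (≤-trans (m≤m*n k k) (m≤m+n (k * k) 1)) k²+1≤A)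
  d : ℕ
  d = proj₁ split
  k+d≡A : k + d ≡ A
  k+d≡A = proj₂ split
  d-lower : suc i * k + 1 ≤ d
  d-lower = +-cancelˡ-≤ k _ _ (begin
    k + (suc i * k + 1) ≡⟨ sym (+-assoc k (suc i * k) 1) ⟩
    k * k + 1           ≤⟨ k²+1≤A ⟩
    A                   ≡⟨ sym k+d≡A ⟩
    k + d               ∎)
  A+1≤k²+k : A + 1 ≤ k * k + k
  A+1≤k²+k = subst (_≤ k * k + k) (+-comm 1 A) A<k²+k
  Ak+1≤[k²+k]k : A * k + 1 ≤ (k * k + k) * k
  Ak+1≤[k²+k]k = begin
    A * k + 1    ≤⟨ +-monoʳ-≤ (A * k) z<s ⟩
    A * k + k    ≡⟨ cong (A * k +_) (sym (*-identityˡ k)) ⟩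
    A * k + 1 * k ≡⟨ sym (*-distribʳ-+ k A 1) ⟩
    (A + 1) * k  ≤⟨ *-monoˡ-≤ k A+1≤k²+k ⟩
    (k * k + k) * k ∎

-- The slack is the Horner form of A(A − k(k+1)²) − k² at A = k + d, d = 1 + k²(k+2) + t.
square-bound : ∀ {k A d} → k + d ≡ A → k * k * (k + 2) < d →
  k * k * ((A + 1) * (A + 1)) ≤ (k * k + 1) * A * d
square-bound {k} refl k²[k+2]<d with m≤n⇒∃[o]m+o≡n k²[k+2]<d
... | t , refl = ≤-trans (m≤m+n _ _) (≤-reflexive (identity k t))
  where
  identity : ∀ k t → let d = 1 + k * k * (k + 2) + t in
    k * k * ((k + d + 1) * (k + d + 1)) + (1 + k * (1 + k * (1 + k)) + t * (2 + k * (1 + k * (2 + k)) + t))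
      ≡ (k * k + 1) * (k + d) * d
  identity = solve-∀

excess-over-k : ∀ {k A} → 2 ≤ k → (k * k + 1) * (k * k + 1) ≤ A → Σ ℕ λ d → k + d ≡ A × k * k * (k + 2) < d
excess-over-k {k@(suc (suc i))} {A} (s≤s (s≤s z≤n)) [k²+1]²≤A = d , k+d≡A , +-cancelˡ-< k _ d (subst (k + k * k * (k + 2) <_) (sym k+d≡A) below-A)
  where
  identity : ∀ i → let k = 2 + i in
    1 + (k + k * k * (k + 2)) + (6 + i * (19 + i * (18 + i * (7 + i)))) ≡ (k * k + 1) * (k * k + 1)
  identity = solve-∀
  below-A : k + k * k * (k + 2) < A
  below-A = <-≤-trans (≤-trans (m≤m+n _ _) (≤-reflexive (identity i))) [k²+1]²≤A
  split : Σ ℕ λ d → k + d ≡ A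
  split = m≤n⇒∃[o]m+o≡n (≤-trans (m≤m+n k _) (<⇒≤ below-A))
  d : ℕ
  d = proj₁ split
  k+d≡A : k + d ≡ A
  k+d≡A = proj₂ split

-- The hypotheses say X ≤ (A+1)(Ak+1)/(A−k) and Y ≥ A(Ak+k+1)/((A+1)k); square-bound makes
-- the ratio of these bounds at most (k²+1)/k.
kX≤[k²+1]Y-for-large-A : ∀ {k A d X Y} → 0 < k → k + d ≡ A → k * k * (k + 2) < d →
  A * X ≤ k * X + (A + 1) * (A * k + 1) → A * (A * k + k + 1) ≤ (A + 1) * k * Y →
  k * X ≤ (k * k + 1) * Y
kX≤[k²+1]Y-for-large-A {k} {A} {d} {X} {Y} 0<k k+d≡A k²[k+2]<d lower upper =
  *-cancelʳ-≤ (k * X) ((k * k + 1) * Y) ((A + 1) * k * d) {{>-nonZero 0<[A+1]kd}} (begin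
    k * X * ((A + 1) * k * d)                   ≡⟨ solve (k ∷ A ∷ d ∷ X ∷ []) ⟩
    k * k * (A + 1) * (d * X)                   ≤⟨ *-monoʳ-≤ (k * k * (A + 1)) dX≤[A+1][Ak+1] ⟩
    k * k * (A + 1) * ((A + 1) * (A * k + 1))   ≡⟨ solve (k ∷ A ∷ []) ⟩
    k * k * ((A + 1) * (A + 1)) * (A * k + 1)   ≤⟨ *-mono-≤ (square-bound k+d≡A k²[k+2]<d) (+-monoˡ-≤ 1 (m≤m+n (A * k) k)) ⟩
    (k * k + 1) * A * d * (A * k + k + 1)       ≡⟨ solve (k ∷ A ∷ d ∷ []) ⟩
    (k * k + 1) * d * (A * (A * k + k + 1))     ≤⟨ *-monoʳ-≤ ((k * k + 1) * d) upper ⟩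
    (k * k + 1) * d * ((A + 1) * k * Y)         ≡⟨ solve (k ∷ A ∷ d ∷ Y ∷ []) ⟩
    (k * k + 1) * Y * ((A + 1) * k * d)         ∎)
  where
  open ≤-Reasoning
  0<[A+1]kd : 0 < (A + 1) * k * d
  0<[A+1]kd = *-mono-≤ (*-mono-≤ (m≤n+m 1 A) 0<k) (≤-<-trans z≤n k²[k+2]<d)
  dX≤[A+1][Ak+1] : d * X ≤ (A + 1) * (A * k + 1)
  dX≤[A+1][Ak+1] = +-cancelˡ-≤ (k * X) _ _ (begin
    k * X + d * X                  ≡⟨ sym (*-distribʳ-+ X k d) ⟩
    (k + d) * X                    ≡⟨ cong (_* X) k+d≡A ⟩
    A * X                          ≤⟨ lower ⟩
    k * X + (A + 1) * (A * k + 1)  ∎)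

-- bᵐ ≤ A guarantees A ≥ (k²+1)² only when m ≥ 2; for m = 1 we have k² < A < cᵐ ≤ k² + k and
-- X ≥ b², and then the lower bound A·X ≤ k·X + (A+1)(Ak+1) fails outright.
kX≤[k²+1]c^m : ∀ {k b c A X} m → 2 ≤ k → k * k + 1 ≤ b → c ≤ k * k + k →
  b ^ m ≤ A → A < c ^ m → b * b ^ m ≤ X →
  A * X ≤ k * X + (A + 1) * (A * k + 1) → A * (A * k + k + 1) ≤ (A + 1) * k * c ^ m →
  k * X ≤ (k * k + 1) * c ^ m
kX≤[k²+1]c^m zero _ _ _ 1≤A A<1 _ _ _ = ⊥-elim (<⇒≱ A<1 1≤A)
kX≤[k²+1]c^m {k} {b} {c} {A} {X} (suc zero) 2≤k k²+1≤b c≤k²+k b*1≤A A<c*1 b*[b*1]≤X lower _ =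
  ⊥-elim (<⇒≱ (cf-lower≤block-fails-for-small-A 2≤k k²+1≤A A<k²+k [k²+1]²≤X) lower)
  where
  k²+1≤A : k * k + 1 ≤ A
  k²+1≤A = ≤-trans k²+1≤b (subst (_≤ A) (*-identityʳ b) b*1≤A)
  A<k²+k : A < k * k + k
  A<k²+k = <-≤-trans (subst (A <_) (*-identityʳ c) A<c*1) c≤k²+k
  [k²+1]²≤X : (k * k + 1) * (k * k + 1) ≤ X
  [k²+1]²≤X = ≤-trans (*-mono-≤ k²+1≤b (subst (k * k + 1 ≤_) (sym (*-identityʳ b)) k²+1≤b)) b*[b*1]≤X
kX≤[k²+1]c^m {k} {b} {c} {A} (suc (suc m)) 2≤k k²+1≤b _ b^[2+m]≤A _ _ lower upper =
  kX≤[k²+1]Y-for-large-A (<⇒≤ 2≤k) (proj₁ (proj₂ excess)) (proj₂ (proj₂ excess)) lower upper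
  where
  b*b≤A : b * b ≤ A
  b*b≤A = ≤-trans (*-monoʳ-≤ b (m≤m*n b (b ^ m) {{m^n≢0 b m {{>-nonZero (≤-trans (m≤n+m 1 (k * k)) k²+1≤b)}}}})) b^[2+m]≤A
  excess : Σ ℕ λ d → k + d ≡ A × k * k * (k + 2) < d
  excess = excess-over-k 2≤k (≤-trans (*-mono-≤ k²+1≤b k²+1≤b) b*b≤A)

k*b^m≤c^m : ∀ {k b c A l m} → 2 ≤ k → k * k + 1 ≤ b → b < c → c ≤ k * k + k → 0 < A →
  b ^ l ≤ b * A → A < c ^ m →
  A / (A * k + 1) ≤ (k * b ^ l + A + 1) / (b * b ^ l) →
  (k * c ^ m + A) / (c * c ^ m) ≤ (A + 1) / (A * k + k + 1) →
  (k * b ^ l + A) / (b * b ^ l) ≤ (k * c ^ m + A + 1) / (c * c ^ m) →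
  k * b ^ m ≤ c ^ m
k*b^m≤c^m {k} {b} {c} {A} {l} {m} 2≤k k²+1≤b b<c c≤k²+k 0<A b^l≤bA A<c^m low up meet =
  *-cancelˡ-≤ b (begin
    b * (k * b ^ m)       ≡⟨ x∙yz≈y∙xz b k (b ^ m) ⟩
    k * b ^ suc m         ≤⟨ *-monoʳ-≤ k b^[1+m]≤b^l ⟩
    k * b ^ l             ≤⟨ kX≤[k²+1]c^m m 2≤k k²+1≤b c≤k²+k b^m≤A A<c^m b^[1+m]≤b^l
                               (cf-lower≤block⇒ {k} {b} {A} {b ^ l} k²+1≤b low)
                               (block≤cf-upper⇒ {k} {c} {A} {c ^ m} c≤k²+k up) ⟩
    (k * k + 1) * c ^ m   ≤⟨ *-monoˡ-≤ (c ^ m) k²+1≤b ⟩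
    b * c ^ m             ∎)
  where
  open ≤-Reasoning
  instance
    b≢0 : NonZero b
    b≢0 = >-nonZero (≤-trans (m≤n+m 1 (k * k)) k²+1≤b)
    c≢0 : NonZero c
    c≢0 = >-nonZero (≤-trans z<s b<c)
  c≤c^m : c ≤ c ^ m
  c≤c^m = ≤-trans (≤-reflexive (sym (*-identityʳ c))) (^-monoʳ-≤ c (^-exponent-pos {c} {A} {m} 0<A A<c^m))
  m<l : m < l
  m<l = ^-exponent-< (<⇒≤ b<c)
    (blocks-overlap⇒< {k} {b} {c} {A} (<⇒≤ 2≤k) (m^n>0 b l) b<c c≤c^m meet)
  b^[1+m]≤b^l : b * b ^ m ≤ b ^ l
  b^[1+m]≤b^l = ^-monoʳ-≤ b m<l
  b^m≤A : b ^ m ≤ A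
  b^m≤A = *-cancelˡ-≤ b (≤-trans b^[1+m]≤b^l b^l≤bA)

-- expScaledHom k a n = n! · Σ_{i ≤ n} aⁱ k^(n−i) / i!, so expScaled m = expScaledHom 1 m.
expScaledHom : ℕ → ℕ → ℕ → ℕ
expScaledHom k a zero = 1
expScaledHom k a (suc n) = suc n * k * expScaledHom k a n + a ^ suc n

binomial-lower-bound : ∀ a n → a ^ suc n + suc n * a ^ n ≤ suc a ^ suc n
binomial-lower-bound a zero = ≤-reflexive (identity a)
  where
  identity : ∀ a → a * 1 + 1 * 1 ≡ suc a * 1
  identity = solve-∀
binomial-lower-bound a (suc n) = begin
  a ^ suc (suc n) + suc (suc n) * a ^ suc n
    ≤⟨ m≤m+n _ (suc n * a ^ n) ⟩
  a ^ suc (suc n) + suc (suc n) * a ^ suc n + suc n * a ^ n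
    ≡⟨ identity a n (a ^ n) ⟩
  suc a * (a ^ suc n + suc n * a ^ n)
    ≤⟨ *-monoʳ-≤ (suc a) (binomial-lower-bound a n) ⟩
  suc a ^ suc (suc n) ∎
  where
  open ≤-Reasoning
  identity : ∀ a n p → a * (a * p) + suc (suc n) * (a * p) + suc n * p ≡ suc a * (a * p + suc n * p)
  identity = solve-∀

-- E(a+1) ≥ E(a) + E′(a) for a polynomial E with nonnegative coefficients, and the a-derivative
-- of expScaledHom k a (n + 1) is (n + 1) · expScaledHom k a n.
expScaledHom-step : ∀ k a n → expScaledHom k a (suc n) + suc n * expScaledHom k a n ≤ expScaledHom k (suc a) (suc n)
expScaledHom-step k a zero = ≤-reflexive (identity k a)
  where
  identity : ∀ k a → 1 * k * 1 + a * 1 + 1 * 1 ≡ 1 * k * 1 + suc a * 1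
  identity = solve-∀
expScaledHom-step k a (suc n) = begin
  E (suc (suc n)) + suc (suc n) * E (suc n)
    ≡⟨ identity n k (E n) (a ^ suc n) (a ^ suc (suc n)) ⟩
  suc (suc n) * k * (E (suc n) + suc n * E n) + (a ^ suc (suc n) + suc (suc n) * a ^ suc n)
    ≤⟨ +-mono-≤ (*-monoʳ-≤ (suc (suc n) * k) (expScaledHom-step k a n)) (binomial-lower-bound a (suc n)) ⟩
  expScaledHom k (suc a) (suc (suc n)) ∎
  where
  open ≤-Reasoning
  E : ℕ → ℕ
  E = expScaledHom k a
  identity : ∀ n k e p₁ p₂ → suc (suc n) * k * (suc n * k * e + p₁) + p₂ + suc (suc n) * (suc n * k * e + p₁)
    ≡ suc (suc n) * k * ((suc n * k * e + p₁) + suc n * e) + (p₂ + suc (suc n) * p₁)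
  identity = solve-∀

expScaledHom-suc : ∀ k a n → suc k * suc n * expScaledHom k a n ≤ expScaledHom k (suc a) (suc n)
expScaledHom-suc k a n = begin
  suc k * suc n * E n                          ≡⟨ identity k n (E n) ⟩
  suc n * k * E n + suc n * E n                ≤⟨ +-monoˡ-≤ (suc n * E n) (m≤m+n (suc n * k * E n) (a ^ suc n)) ⟩
  expScaledHom k a (suc n) + suc n * E n       ≤⟨ expScaledHom-step k a n ⟩
  expScaledHom k (suc a) (suc n)               ∎
  where
  open ≤-Reasoning
  E : ℕ → ℕ
  E = expScaledHom k a
  identity : ∀ k n e → suc k * suc n * e ≡ suc n * k * e + suc n * e
  identity = solve-∀

suc-pow*fact≤expScaledHom : ∀ k n → suc k ^ n * n ! ≤ expScaledHom k n n
suc-pow*fact≤expScaledHom k zero = ≤-refl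
suc-pow*fact≤expScaledHom k (suc n) = begin
  suc k ^ suc n * suc n !           ≡⟨ identity k n (suc k ^ n) (n !) ⟩
  suc k * suc n * (suc k ^ n * n !) ≤⟨ *-monoʳ-≤ (suc k * suc n) (suc-pow*fact≤expScaledHom k n) ⟩
  suc k * suc n * expScaledHom k n n ≤⟨ expScaledHom-suc k n n ⟩
  expScaledHom k (suc n) (suc n)    ∎
  where
  open ≤-Reasoning
  identity : ∀ k n p f → suc k * p * (suc n * f) ≡ suc k * suc n * (p * f)
  identity = solve-∀

^-distrib-* : ∀ x y n → (x * y) ^ n ≡ x ^ n * y ^ n
^-distrib-* x y zero = refl
^-distrib-* x y (suc n) = begin
  x * y * (x * y) ^ n     ≡⟨ cong (x * y *_) (^-distrib-* x y n) ⟩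
  x * y * (x ^ n * y ^ n) ≡⟨ interchange x y (x ^ n) (y ^ n) ⟩
  x * x ^ n * (y * y ^ n) ∎
  where open ≡-Reasoning

expScaledHom-multiple : ∀ k m n → expScaledHom k (m * k) n ≡ k ^ n * expScaled m n
expScaledHom-multiple k m zero = refl
expScaledHom-multiple k m (suc n) = begin
  suc n * k * expScaledHom k (m * k) n + (m * k) ^ suc n
    ≡⟨ cong₂ (λ e p → suc n * k * e + p) (expScaledHom-multiple k m n) (^-distrib-* m k (suc n)) ⟩
  suc n * k * (k ^ n * expScaled m n) + m ^ suc n * (k * k ^ n)
    ≡⟨ identity n k (k ^ n) (expScaled m n) (m ^ suc n) ⟩
  k * k ^ n * (suc n * expScaled m n + m ^ suc n) ∎
  where
  open ≡-Reasoning
  identity : ∀ n k p s q → suc n * k * (p * s) + q * (k * p) ≡ k * p * (suc n * s + q)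
  identity = solve-∀

suc-pow≤expScaled : ∀ k m → suc k ^ (m * k) * (m * k) ! ≤ k ^ (m * k) * expScaled m (m * k)
suc-pow≤expScaled k m =
  ≤-trans (suc-pow*fact≤expScaledHom k (m * k)) (≤-reflexive (expScaledHom-multiple k m (m * k)))

GtKLogK-of-pow-bound : ∀ k m → k ^ k * k ^ (m * k) < suc k ^ (m * k) → GtKLogK m k
GtKLogK-of-pow-bound k m k^k*k^N<[1+k]^N = N , *-cancelʳ-< _ _ _ (begin-strict
  k ^ k * N ! * k ^ N     ≡⟨ xy∙z≈xz∙y (k ^ k) (N !) (k ^ N) ⟩
  k ^ k * k ^ N * N !     <⟨ *-monoˡ-< (N !) {{N !≢0}} k^k*k^N<[1+k]^N ⟩
  suc k ^ N * N !         ≤⟨ suc-pow≤expScaled k m ⟩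
  k ^ N * expScaled m N   ≡⟨ *-comm (k ^ N) _ ⟩
  expScaled m N * k ^ N   ∎)
  where
  open ≤-Reasoning
  N : ℕ
  N = m * k

pow-bound-of-ratio : ∀ {k b c m} → 0 < k → 0 < m → k * b ^ m ≤ c ^ m → c * k < suc k * b →
  k ^ k * k ^ (m * k) < suc k ^ (m * k)
pow-bound-of-ratio {k} {b} {c} {m} 0<k 0<m kb^m≤c^m ck<[1+k]b = *-cancelʳ-< _ _ _ (begin-strict
  k ^ k * k ^ N * b ^ N        ≡⟨ xy∙z≈xz∙y (k ^ k) (k ^ N) (b ^ N) ⟩
  k ^ k * b ^ N * k ^ N        ≡⟨ cong (λ e → k ^ k * e * k ^ N) (sym (^-*-assoc b m k)) ⟩
  k ^ k * (b ^ m) ^ k * k ^ N  ≡⟨ cong (_* k ^ N) (sym (^-distrib-* k (b ^ m) k)) ⟩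
  (k * b ^ m) ^ k * k ^ N      ≤⟨ *-monoˡ-≤ (k ^ N) (^-monoˡ-≤ k kb^m≤c^m) ⟩
  (c ^ m) ^ k * k ^ N          ≡⟨ cong (_* k ^ N) (^-*-assoc c m k) ⟩
  c ^ N * k ^ N                ≡⟨ sym (^-distrib-* c k N) ⟩
  (c * k) ^ N                  <⟨ ^-monoˡ-< N {{>-nonZero (*-mono-≤ 0<m 0<k)}} ck<[1+k]b ⟩
  (suc k * b) ^ N              ≡⟨ ^-distrib-* (suc k) b N ⟩
  suc k ^ N * b ^ N            ∎)
  where
  open ≤-Reasoning
  N : ℕ
  N = m * k

ck<[1+k]b : ∀ {k b c} → k * k + 1 ≤ b → c ≤ k * k + k → c * k < suc k * b
ck<[1+k]b {k} {b} {c} k²+1≤b c≤k²+k = begin-strict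
  c * k                       ≤⟨ *-monoˡ-≤ k c≤k²+k ⟩
  (k * k + k) * k             <⟨ m<m+n _ z<s ⟩
  (k * k + k) * k + suc k     ≡⟨ identity k ⟩
  suc k * (k * k + 1)         ≤⟨ *-monoʳ-≤ (suc k) k²+1≤b ⟩
  suc k * b                   ∎
  where
  open ≤-Reasoning
  identity : ∀ k → (k * k + k) * k + suc k ≡ suc k * (k * k + 1)
  identity = solve-∀

GtKLogK-of-ratio : ∀ {k b c m} → 2 ≤ k → k * k + 1 ≤ b → c ≤ k * k + k → k * b ^ m ≤ c ^ m → GtKLogK m k
GtKLogK-of-ratio {k} {m = zero} 2≤k _ _ k*1≤1 = ⊥-elim (<⇒≱ 2≤k (subst (_≤ 1) (*-identityʳ k) k*1≤1))
GtKLogK-of-ratio {k} {b} {c} {suc m} 2≤k k²+1≤b c≤k²+k kb^m≤c^m =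
  GtKLogK-of-pow-bound k (suc m)
    (pow-bound-of-ratio {k} {b} {c} {suc m} (<⇒≤ 2≤k) z<s kb^m≤c^m (ck<[1+k]b {k} {b} {c} k²+1≤b c≤k²+k))

lemma6p10 : (k b c : ℕ) → 2 ≤ k → k * k + 1 ≤ b → b < c → c ≤ k * k + k →
    (a : ℕ → ℕ) → a 0 ≡ k → IsTrott b a → IsTrott c a →
    (l m : ℕ) → l ≡ ndigits b (a 1) → m ≡ ndigits c (a 1) →
    GtKLogK m k
lemma6p10 k b c 2≤k k²+1≤b b<c c≤k²+k a a₀≡k tb@(pos , b-expansion) tc@(_ , c-expansion) _ _ refl refl =
  GtKLogK-of-ratio 2≤k k²+1≤b c≤k²+k
    (k*b^m≤c^m {k} {b} {c} {a 1} {ndigits b (a 1)} {ndigits c (a 1)} 2≤k k²+1≤b b<c c≤k²+k (pos 1)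
      (proj₂ (ndigits-bounds 2≤b (pos 1))) (proj₁ (ndigits-bounds 2≤c (pos 1)))
      (proj₁ (second-block-bounds k<b b-expansion)) (proj₂ (second-block-bounds k<c c-expansion))
      (second-blocks-overlap k<b k<c tb tc))
  where
  open SecondBlock pos a₀≡k
  k<b : k < b
  k<b = <-≤-trans (s≤s (m≤m*n k k {{>-nonZero (<⇒≤ 2≤k)}})) (subst (_≤ b) (+-comm (k * k) 1) k²+1≤b)
  k<c : k < c
  k<c = <-trans k<b b<c
  2≤b : 2 ≤ b
  2≤b = <⇒≤ (≤-<-trans 2≤k k<b)
  2≤c : 2 ≤ c
  2≤c = ≤-trans 2≤b (<⇒≤ b<c)
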